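{- Let $S=\{x_1,\ldots,x_n\}$ be a gcd-closed set of distinct positive integers with $x_1<x_2<\cdots<x_n$. For $j>1$ we have $\sum_{i=1}^{n}c_{ij}=0$, equivalently $\sum_{x_i\mid x_j}c_{ij}=0$.
   Context: $\mu$ is the Möbius function. $S$ is gcd-closed if $\gcd(x,y)\in S$ for all $x,y\in S$. $c_{ij}=\sum\mu(d)$ over positive integers $d$ with $dx_i\mid x_j$ and $dx_i\nmid x_t$ for every $x_t\in S$ with $x_t<x_j$. -}

module Defs where

open import Data.Bool using (Bool; true; false; if_then_else_; _∨_)
open import Data.Nat using (ℕ; zero; suc; _*_; _<_; _<ᵇ_; _<?_)
open import Data.Nat.Divisibility using (_∣?_)
open import Data.Nat.Primality using (prime?)
open import Data.Integer as ℤ using (ℤ; 0ℤ; 1ℤ; -1ℤ)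
open import Data.Fin using (Fin)
open import Data.Fin.Properties using (all?)
open import Data.List using (List; []; _∷_; upTo; map; filter; length; foldr; allFin)
open import Data.Bool.ListAction using (and)

open import Relation.Nullary using (¬?; does)
open import Relation.Nullary.Decidable using (_×-dec_; _→-dec_)

sumℤ : List ℤ → ℤ
sumℤ = foldr ℤ._+_ 0ℤ

range1 : ℕ → List ℕ
range1 m = map suc (upTo m)

primeDivisors : ℕ → List ℕ
primeDivisors n = filter (λ p → prime? p ×-dec p ∣? n) (upTo (suc n))

-- n is squarefree: no k ≥ 2 with k² ∣ n  (for n ≥ 1 such k satisfies k ≤ n)
squarefreeᵇ : ℕ → Bool
squarefreeᵇ n = and (map (λ k → (k <ᵇ 2) ∨ Relation.Nullary.does (¬? (k * k ∣? n))) (upTo (suc n)))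

signPow : ℕ → ℤ
signPow zero = 1ℤ
signPow (suc k) = ℤ.- signPow k

-- Möbius function (meaningful for n ≥ 1):
-- μ(n) = (-1)^(number of prime factors) if n squarefree, 0 otherwise
μ : ℕ → ℤ
μ n = if squarefreeᵇ n then signPow (length (primeDivisors n)) else 0ℤ

-- c_{ij} = Σ μ(d) over positive d with d x_i ∣ x_j and d x_i ∤ x_t for all x_t < x_j.
-- Since x_j ≥ 1, d x_i ∣ x_j forces d ≤ x_j, so d ranges over [1 .. x_j].
c : ∀ {n} → (Fin n → ℕ) → Fin n → Fin n → ℤ
c x i j = sumℤ (map (λ d →
    if does ((d * x i ∣? x j) ×-dec all? (λ t → (x t <? x j) →-dec ¬? (d * x i ∣? x t)))
    then μ d else 0ℤ) (range1 (x j)))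

sumAllC : ∀ {n} → (Fin n → ℕ) → Fin n → ℤ
sumAllC {n} x j = sumℤ (map (λ i → c x i j) (allFin n))

sumDivC : ∀ {n} → (Fin n → ℕ) → Fin n → ℤ
sumDivC {n} x j = sumℤ (map (λ i → c x i j) (filter (λ i → x i ∣? x j) (allFin n)))

module Submission where

-- Proof of the vanishing column sums  Σ_i c_{ij} = 0  (j > 1) for a
-- gcd-closed set x_1 < ... < x_n, by a sieve argument.  (Indices are
-- 0-based in the code, so the hypothesis j > 1 reads 1 ≤ toℕ j.)
--
-- Put X = x_j.  For a test function h : ℕ → ℤ consider the functional
--   Φ h = Σ_i Σ_{d ≤ X} μ(d) h(d x_i).
-- Then Σ_i c_{ij} = Φ A, where A(m) = [m ∣ X and m ∤ x_t for all x_t < X].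
-- Möbius orthogonality  Σ_{d ≤ B} μ(d) [d a ∣ N] = [a = N]  gives
-- Φ [· ∣ x_k] = 1 for every x_k ≤ X, because only i = k contributes.
-- Writing U_L(m) = [m divides some x_u, u ∈ L], inclusion–exclusion and
-- gcd-closedness (m ∣ x_t and m ∣ x_u iff m ∣ gcd(x_t, x_u) = x_v) give
-- Φ U_L = 1 for every non-empty L of indices with x_u ≤ X.  Finally
-- A = [· ∣ X] − U_L  with L = {gcd(x_j, x_t) : x_t < X}, which is
-- non-empty because j > 1, so Φ A = 1 − 1 = 0.  Dropping the terms with
-- x_i ∤ x_j changes nothing, since then c_{ij} = 0.

open import Defs
open import Data.Bool using (Bool; true; false; T; if_then_else_; _∨_)
open import Data.Bool.Properties using (T-≡)
open import Data.Empty using (⊥-elim)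
open import Data.Unit using (tt)
open import Data.Sum using (_⊎_; inj₁; inj₂; [_,_]′)
open import Function.Base using (_∘′_)
open import Data.Product using (_×_; _,_; proj₁; proj₂; ∃-syntax)
open import Data.Nat using (ℕ; zero; suc; _+_; _*_; _<_; _≤_; z≤n; s≤s; NonZero; >-nonZero; >-nonZero⁻¹; nonTrivial⇒n>1; _<ᵇ_; _≟_; _<?_)
import Data.Nat.Properties as ℕP
open import Data.Nat.Divisibility
open import Data.Nat.GCD using (gcd; gcd[m,n]∣m; gcd[m,n]∣n; gcd-greatest)
open import Data.Nat.Primality using (Prime; prime?; euclidsLemma; prime⇒irreducible; prime⇒nonZero; prime⇒nonTrivial; ¬prime[1])
open import Data.Nat.Primality.Factorisation using (factorise)
open import Data.Nat.ListAction using (product)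
open import Data.Nat.Coprimality using (Coprime; coprime-divisor)
open import Data.Integer using (ℤ; 0ℤ; 1ℤ; -_) renaming (_+_ to _+ℤ_; _*_ to _*ℤ_; _-_ to _-ℤ_)
import Data.Integer.Properties as ℤP
open import Data.Fin as Fin using (Fin; toℕ)
import Data.Fin.Properties as FinP
open import Data.List using (List; []; _∷_; _++_; [_]; map; filter; length; upTo; allFin; tabulate)
import Data.List.Properties as ListP
open import Data.List.Relation.Unary.All using (All; []; _∷_; universal)
import Data.List.Relation.Unary.All.Properties as AllP
open import Data.List.Relation.Unary.Any as Any using (Any; here; there; any?)
import Data.List.Relation.Unary.Any.Properties as AnyP
open import Data.List.Membership.Propositional using (_∈_; find; lose)
import Data.List.Membership.Propositional.Properties as ∈P
open import Function.Bundles using (_⇔_; mk⇔; Equivalence)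
open import Relation.Nullary using (¬_; Dec; yes; no; does; ¬?)
open import Relation.Nullary.Decidable using (_×-dec_; _→-dec_)
open import Relation.Binary using (tri<; tri≈; tri>)
open import Relation.Binary.PropositionalEquality hiding ([_])
open import Algebra.Properties.CommutativeSemigroup ℤP.+-commutativeSemigroup using () renaming (interchange to +ℤ-interchange)
open import Algebra.Properties.CommutativeSemigroup ℕP.+-commutativeSemigroup using () renaming (interchange to +-interchange)

open Equivalence using (to; from)

when : ∀ {P : Set} → Dec P → ℤ → ℤ
when D a = if does D then a else 0ℤ

𝟙 : ∀ {P : Set} → Dec P → ℤ
𝟙 D = when D 1ℤ

when-yes : ∀ {P : Set} (D : Dec P) {a} → P → when D a ≡ a
when-yes (yes _) _ = refl
when-yes (no ¬p) p = ⊥-elim (¬p p)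

when-no : ∀ {P : Set} (D : Dec P) {a} → ¬ P → when D a ≡ 0ℤ
when-no (yes p) ¬p = ⊥-elim (¬p p)
when-no (no _) _ = refl

when-0 : ∀ {P : Set} (D : Dec P) → when D 0ℤ ≡ 0ℤ
when-0 (yes _) = refl
when-0 (no _) = refl

when-neg : ∀ {P : Set} (D : Dec P) a → when D (- a) ≡ - when D a
when-neg (yes _) a = refl
when-neg (no _) a = refl

when-scale : ∀ {P : Set} (D : Dec P) a → when D a ≡ a *ℤ 𝟙 D
when-scale (yes _) a = sym (ℤP.*-identityʳ a)
when-scale (no _) a = sym (ℤP.*-zeroʳ a)

when-split : ∀ {P : Set} (D : Dec P) a → a ≡ when (¬? D) a +ℤ when D a
when-split (yes _) a = sym (ℤP.+-identityˡ a)
when-split (no _) a = sym (ℤP.+-identityʳ a)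

when-cong : ∀ {P Q : Set} (DP : Dec P) (DQ : Dec Q) {a} → P ⇔ Q → when DP a ≡ when DQ a
when-cong DP DQ P⇔Q with DP
... | yes p = sym (when-yes DQ (to P⇔Q p))
... | no ¬p = sym (when-no DQ (λ q → ¬p (from P⇔Q q)))

𝟙-∨ : ∀ {A B O C : Set} (DA : Dec A) (DB : Dec B) (DO : Dec O) (DC : Dec C)
    → O ⇔ (A ⊎ B) → C ⇔ (A × B) → 𝟙 DO ≡ (𝟙 DA +ℤ 𝟙 DB) -ℤ 𝟙 DC
𝟙-∨ (yes a) (yes b) DO DC O⇔ C⇔ rewrite when-yes DO {1ℤ} (from O⇔ (inj₁ a)) | when-yes DC {1ℤ} (from C⇔ (a , b)) = refl
𝟙-∨ (yes a) (no ¬b) DO DC O⇔ C⇔ rewrite when-yes DO {1ℤ} (from O⇔ (inj₁ a)) | when-no DC {1ℤ} (¬b ∘′ proj₂ ∘′ to C⇔) = refl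
𝟙-∨ (no ¬a) (yes b) DO DC O⇔ C⇔ rewrite when-yes DO {1ℤ} (from O⇔ (inj₂ b)) | when-no DC {1ℤ} (¬a ∘′ proj₁ ∘′ to C⇔) = refl
𝟙-∨ (no ¬a) (no ¬b) DO DC O⇔ C⇔ rewrite when-no DO {1ℤ} ([ ¬a , ¬b ]′ ∘′ to O⇔) | when-no DC {1ℤ} (¬a ∘′ proj₁ ∘′ to C⇔) = refl

𝟙-∖ : ∀ {A B O C : Set} (DA : Dec A) (DB : Dec B) (DO : Dec O) (DC : Dec C)
    → O ⇔ (A × ¬ B) → C ⇔ (A × B) → 𝟙 DO ≡ 𝟙 DA -ℤ 𝟙 DC
𝟙-∖ (no ¬a) DB DO DC O⇔ C⇔ rewrite when-no DO {1ℤ} (¬a ∘′ proj₁ ∘′ to O⇔) | when-no DC {1ℤ} (¬a ∘′ proj₁ ∘′ to C⇔) = refl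
𝟙-∖ (yes a) (yes b) DO DC O⇔ C⇔ rewrite when-no DO {1ℤ} (λ o → proj₂ (to O⇔ o) b) | when-yes DC {1ℤ} (from C⇔ (a , b)) = refl
𝟙-∖ (yes a) (no ¬b) DO DC O⇔ C⇔ rewrite when-yes DO {1ℤ} (from O⇔ (a , ¬b)) | when-no DC {1ℤ} (¬b ∘′ proj₂ ∘′ to C⇔) = refl

sumMap : ∀ {A : Set} → (A → ℤ) → List A → ℤ
sumMap f xs = sumℤ (map f xs)

sumTo : (ℕ → ℤ) → ℕ → ℤ
sumTo f B = sumMap f (range1 B)

module _ {A : Set} where

  sumMap-cong : ∀ {f g : A → ℤ} xs → (∀ a → f a ≡ g a) → sumMap f xs ≡ sumMap g xs
  sumMap-cong xs f≗g = cong sumℤ (ListP.map-cong f≗g xs)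

  sumMap-++ : ∀ (f : A → ℤ) xs ys → sumMap f (xs ++ ys) ≡ sumMap f xs +ℤ sumMap f ys
  sumMap-++ f [] ys = sym (ℤP.+-identityˡ _)
  sumMap-++ f (a ∷ xs) ys = trans (cong (f a +ℤ_) (sumMap-++ f xs ys)) (sym (ℤP.+-assoc (f a) _ _))

  sumMap-+ : ∀ (f g : A → ℤ) xs → sumMap (λ a → f a +ℤ g a) xs ≡ sumMap f xs +ℤ sumMap g xs
  sumMap-+ f g [] = refl
  sumMap-+ f g (a ∷ xs) = trans (cong (f a +ℤ g a +ℤ_) (sumMap-+ f g xs)) (+ℤ-interchange (f a) (g a) _ _)

  sumMap-neg : ∀ (f : A → ℤ) xs → sumMap (λ a → - f a) xs ≡ - sumMap f xs
  sumMap-neg f [] = refl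
  sumMap-neg f (a ∷ xs) = trans (cong (- f a +ℤ_) (sumMap-neg f xs)) (sym (ℤP.neg-distrib-+ (f a) _))

  sumMap-zero : ∀ {f : A → ℤ} xs → (∀ a → f a ≡ 0ℤ) → sumMap f xs ≡ 0ℤ
  sumMap-zero [] f≡0 = refl
  sumMap-zero (a ∷ xs) f≡0 = cong₂ _+ℤ_ (f≡0 a) (sumMap-zero xs f≡0)

  sumMap-filter : ∀ {P : A → Set} (P? : ∀ a → Dec (P a)) (f : A → ℤ) xs
                → (∀ a → ¬ P a → f a ≡ 0ℤ) → sumMap f (filter P? xs) ≡ sumMap f xs
  sumMap-filter P? f [] _ = refl
  sumMap-filter P? f (a ∷ xs) f≡0 with P? a
  ... | yes _ = cong (f a +ℤ_) (sumMap-filter P? f xs f≡0)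
  ... | no ¬Pa = trans (sumMap-filter P? f xs f≡0) (sym (trans (cong (_+ℤ sumMap f xs) (f≡0 a ¬Pa)) (ℤP.+-identityˡ _)))

sumMap-allFin-point : ∀ n (f : Fin n → ℤ) k → (∀ i → i ≢ k → f i ≡ 0ℤ) → sumMap f (allFin n) ≡ f k
sumMap-allFin-point n f k f≡0 = trans (cong sumℤ (ListP.map-tabulate (λ i → i) f)) (tabulate-point n f k f≡0)
  where
  tabulate-point : ∀ n (f : Fin n → ℤ) k → (∀ i → i ≢ k → f i ≡ 0ℤ) → sumℤ (tabulate f) ≡ f k
  tabulate-point (suc n) f Fin.zero f≡0 = begin
    f Fin.zero +ℤ sumℤ (tabulate (f ∘′ Fin.suc))
      ≡⟨ cong (f Fin.zero +ℤ_) (sym (cong sumℤ (ListP.map-tabulate (λ i → i) (f ∘′ Fin.suc)))) ⟩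
    f Fin.zero +ℤ sumMap (f ∘′ Fin.suc) (allFin n)
      ≡⟨ cong (f Fin.zero +ℤ_) (sumMap-zero (allFin n) (λ i → f≡0 (Fin.suc i) (λ ()))) ⟩
    f Fin.zero +ℤ 0ℤ
      ≡⟨ ℤP.+-identityʳ _ ⟩
    f Fin.zero ∎
    where open ≡-Reasoning
  tabulate-point (suc n) f (Fin.suc k) f≡0 = begin
    f Fin.zero +ℤ sumℤ (tabulate (f ∘′ Fin.suc))
      ≡⟨ cong₂ _+ℤ_ (f≡0 Fin.zero (λ ())) (tabulate-point n (f ∘′ Fin.suc) k (λ i i≢k → f≡0 (Fin.suc i) (i≢k ∘′ FinP.suc-injective))) ⟩
    0ℤ +ℤ f (Fin.suc k)
      ≡⟨ ℤP.+-identityˡ _ ⟩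
    f (Fin.suc k) ∎
    where open ≡-Reasoning

sumTo-suc : ∀ f B → sumTo f (suc B) ≡ sumTo f B +ℤ f (suc B)
sumTo-suc f B = begin
  sumMap f (map suc (upTo (suc B)))          ≡⟨ cong (sumMap f ∘′ map suc) (sym (ListP.upTo-∷ʳ B)) ⟩
  sumMap f (map suc (upTo B ++ [ B ]))       ≡⟨ cong (sumMap f) (ListP.map-++ suc (upTo B) [ B ]) ⟩
  sumMap f (range1 B ++ [ suc B ])           ≡⟨ sumMap-++ f (range1 B) [ suc B ] ⟩
  sumTo f B +ℤ (f (suc B) +ℤ 0ℤ)             ≡⟨ cong (sumTo f B +ℤ_) (ℤP.+-identityʳ _) ⟩
  sumTo f B +ℤ f (suc B)                     ∎
  where open ≡-Reasoning

sumTo-cong : ∀ {f g} B → (∀ d → 0 < d → d ≤ B → f d ≡ g d) → sumTo f B ≡ sumTo g B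
sumTo-cong zero _ = refl
sumTo-cong {f} {g} (suc B) f≗g = begin
  sumTo f (suc B)          ≡⟨ sumTo-suc f B ⟩
  sumTo f B +ℤ f (suc B)   ≡⟨ cong₂ _+ℤ_ (sumTo-cong B (λ d 0<d d≤B → f≗g d 0<d (ℕP.m≤n⇒m≤1+n d≤B))) (f≗g (suc B) (s≤s z≤n) ℕP.≤-refl) ⟩
  sumTo g B +ℤ g (suc B)   ≡⟨ sym (sumTo-suc g B) ⟩
  sumTo g (suc B)          ∎
  where open ≡-Reasoning

sumTo-zero : ∀ {f} B → (∀ d → 0 < d → d ≤ B → f d ≡ 0ℤ) → sumTo f B ≡ 0ℤ
sumTo-zero B f≡0 = trans (sumTo-cong B f≡0) (sumMap-zero (range1 B) (λ _ → refl))

sumTo-truncate : ∀ f K B → (∀ d → K < d → f d ≡ 0ℤ) → K ≤ B → sumTo f B ≡ sumTo f K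
sumTo-truncate f K zero _ z≤n = refl
sumTo-truncate f K (suc B) f≡0 K≤1+B with ℕP.m≤n⇒m<n∨m≡n K≤1+B
... | inj₂ refl = refl
... | inj₁ K<1+B = begin
  sumTo f (suc B)          ≡⟨ sumTo-suc f B ⟩
  sumTo f B +ℤ f (suc B)   ≡⟨ cong₂ _+ℤ_ (sumTo-truncate f K B f≡0 (ℕP.≤-pred K<1+B)) (f≡0 (suc B) K<1+B) ⟩
  sumTo f K +ℤ 0ℤ          ≡⟨ ℤP.+-identityʳ _ ⟩
  sumTo f K                ∎
  where open ≡-Reasoning

sumTo-point : ∀ f a B → (∀ d → 0 < d → d ≤ B → d ≢ a → f d ≡ 0ℤ) → 0 < a → a ≤ B → sumTo f B ≡ f a
sumTo-point f (suc a) zero f≡0 0<a ()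
sumTo-point f a (suc B) f≡0 0<a a≤1+B with ℕP.m≤n⇒m<n∨m≡n a≤1+B
... | inj₂ refl = begin
  sumTo f (suc B)    ≡⟨ sumTo-suc f B ⟩
  sumTo f B +ℤ f a   ≡⟨ cong (_+ℤ f a) (sumTo-zero B (λ d 0<d d≤B → f≡0 d 0<d (ℕP.m≤n⇒m≤1+n d≤B) (ℕP.<⇒≢ (s≤s d≤B)))) ⟩
  0ℤ +ℤ f a          ≡⟨ ℤP.+-identityˡ _ ⟩
  f a                ∎
  where open ≡-Reasoning
... | inj₁ a<1+B = begin
  sumTo f (suc B)
    ≡⟨ sumTo-suc f B ⟩
  sumTo f B +ℤ f (suc B)
    ≡⟨ cong₂ _+ℤ_ (sumTo-point f a B f≡0' 0<a (ℕP.≤-pred a<1+B)) (f≡0 (suc B) (s≤s z≤n) ℕP.≤-refl (ℕP.<⇒≢ a<1+B ∘′ sym)) ⟩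
  f a +ℤ 0ℤ
    ≡⟨ ℤP.+-identityʳ _ ⟩
  f a ∎
  where
  open ≡-Reasoning
  f≡0' : ∀ d → 0 < d → d ≤ B → d ≢ a → f d ≡ 0ℤ
  f≡0' d 0<d d≤B = f≡0 d 0<d (ℕP.m≤n⇒m≤1+n d≤B)

sumTo-shift : ∀ f a b → sumTo f (b + a) ≡ sumTo f a +ℤ sumTo (λ r → f (r + a)) b
sumTo-shift f a zero = sym (ℤP.+-identityʳ _)
sumTo-shift f a (suc b) = begin
  sumTo f (suc (b + a))                                      ≡⟨ sumTo-suc f (b + a) ⟩
  sumTo f (b + a) +ℤ f (suc b + a)                           ≡⟨ cong (_+ℤ f (suc b + a)) (sumTo-shift f a b) ⟩
  (sumTo f a +ℤ sumTo g b) +ℤ f (suc b + a)                  ≡⟨ ℤP.+-assoc (sumTo f a) _ _ ⟩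
  sumTo f a +ℤ (sumTo g b +ℤ g (suc b))                      ≡⟨ cong (sumTo f a +ℤ_) (sym (sumTo-suc g b)) ⟩
  sumTo f a +ℤ sumTo g (suc b)                               ∎
  where
  open ≡-Reasoning
  g : ℕ → ℤ
  g r = f (r + a)

sumTo-multiples : ∀ f p K → 0 < p → (∀ d → ¬ p ∣ d → f d ≡ 0ℤ) → sumTo f (p * K) ≡ sumTo (λ e → f (p * e)) K
sumTo-multiples f p zero _ _ = cong (sumTo f) (ℕP.*-zeroʳ p)
sumTo-multiples f p (suc K) 0<p f≡0 = begin
  sumTo f (p * suc K)                                  ≡⟨ cong (sumTo f) (ℕP.*-suc p K) ⟩
  sumTo f (p + p * K)                                  ≡⟨ sumTo-shift f (p * K) p ⟩
  sumTo f (p * K) +ℤ sumTo (λ r → f (r + p * K)) p     ≡⟨ cong₂ _+ℤ_ (sumTo-multiples f p K 0<p f≡0) lastBlock ⟩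
  sumTo (λ e → f (p * e)) K +ℤ f (p * suc K)           ≡⟨ sym (sumTo-suc (λ e → f (p * e)) K) ⟩
  sumTo (λ e → f (p * e)) (suc K)                      ∎
  where
  open ≡-Reasoning
  offBlock : ∀ r → 0 < r → r ≤ p → r ≢ p → f (r + p * K) ≡ 0ℤ
  offBlock r 0<r r≤p r≢p = f≡0 (r + p * K) λ p∣r+pK →
    r≢p (ℕP.≤-antisym r≤p (∣⇒≤ ⦃ >-nonZero 0<r ⦄ (∣m+n∣m⇒∣n (subst (p ∣_) (ℕP.+-comm r (p * K)) p∣r+pK) (m∣m*n K))))
  lastBlock : sumTo (λ r → f (r + p * K)) p ≡ f (p * suc K)
  lastBlock = trans (sumTo-point _ p p offBlock 0<p ℕP.≤-refl) (cong f (sym (ℕP.*-suc p K)))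

indicator : ∀ {P : Set} → Dec P → ℕ
indicator D = if does D then 1 else 0

count : ∀ {P : ℕ → Set} → (∀ q → Dec (P q)) → ℕ → ℕ
count P? N = length (filter P? (upTo N))

indicator-cong : ∀ {P Q : Set} (DP : Dec P) (DQ : Dec Q) → P ⇔ Q → indicator DP ≡ indicator DQ
indicator-cong (yes _) (yes _) _ = refl
indicator-cong (yes p) (no ¬q) P⇔Q = ⊥-elim (¬q (to P⇔Q p))
indicator-cong (no ¬p) (yes q) P⇔Q = ⊥-elim (¬p (from P⇔Q q))
indicator-cong (no _) (no _) _ = refl

indicator-yes : ∀ {P : Set} (D : Dec P) → P → indicator D ≡ 1
indicator-yes (yes _) _ = refl
indicator-yes (no ¬p) p = ⊥-elim (¬p p)

indicator-no : ∀ {P : Set} (D : Dec P) → ¬ P → indicator D ≡ 0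
indicator-no (yes p) ¬p = ⊥-elim (¬p p)
indicator-no (no _) _ = refl

indicator-⊎ : ∀ {P R Q : Set} (DP : Dec P) (DR : Dec R) (DQ : Dec Q)
            → P ⇔ (R ⊎ Q) → (R → ¬ Q) → indicator DP ≡ indicator DR + indicator DQ
indicator-⊎ DP (yes r) (yes q) _ disjoint = ⊥-elim (disjoint r q)
indicator-⊎ DP (yes r) (no _) P⇔ _ = indicator-yes DP (from P⇔ (inj₁ r))
indicator-⊎ DP (no _) (yes q) P⇔ _ = indicator-yes DP (from P⇔ (inj₂ q))
indicator-⊎ DP (no ¬r) (no ¬q) P⇔ _ = indicator-no DP ([ ¬r , ¬q ]′ ∘′ to P⇔)

module _ {P : ℕ → Set} (P? : ∀ q → Dec (P q)) where

  count-suc : ∀ N → count P? (suc N) ≡ count P? N + indicator (P? N)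
  count-suc N = begin
    length (filter P? (upTo (suc N)))                 ≡⟨ cong (length ∘′ filter P?) (sym (ListP.upTo-∷ʳ N)) ⟩
    length (filter P? (upTo N ++ [ N ]))              ≡⟨ cong length (ListP.filter-++ P? (upTo N) [ N ]) ⟩
    length (filter P? (upTo N) ++ filter P? [ N ])    ≡⟨ ListP.length-++ (filter P? (upTo N)) ⟩
    count P? N + length (filter P? [ N ])             ≡⟨ cong (count P? N +_) singleton ⟩
    count P? N + indicator (P? N)                     ∎
    where
    open ≡-Reasoning
    singleton : length (filter P? [ N ]) ≡ indicator (P? N)
    singleton with P? N
    ... | yes _ = refl
    ... | no _ = refl

  count-none : ∀ N → (∀ q → q < N → ¬ P q) → count P? N ≡ 0
  count-none zero _ = refl
  count-none (suc N) ¬P = begin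
    count P? (suc N)                ≡⟨ count-suc N ⟩
    count P? N + indicator (P? N)   ≡⟨ cong₂ _+_ (count-none N (λ q q<N → ¬P q (ℕP.m≤n⇒m≤1+n q<N))) (indicator-no (P? N) (¬P N ℕP.≤-refl)) ⟩
    0                               ∎
    where open ≡-Reasoning

  count-truncate : ∀ M N → (∀ q → M ≤ q → ¬ P q) → M ≤ N → count P? N ≡ count P? M
  count-truncate M zero _ z≤n = refl
  count-truncate M (suc N) ¬P M≤1+N with ℕP.m≤n⇒m<n∨m≡n M≤1+N
  ... | inj₂ refl = refl
  ... | inj₁ M<1+N = begin
    count P? (suc N)                ≡⟨ count-suc N ⟩
    count P? N + indicator (P? N)   ≡⟨ cong₂ _+_ (count-truncate M N ¬P (ℕP.≤-pred M<1+N)) (indicator-no (P? N) (¬P N (ℕP.≤-pred M<1+N))) ⟩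
    count P? M + 0                  ≡⟨ ℕP.+-identityʳ _ ⟩
    count P? M                      ∎
    where open ≡-Reasoning

count-+ : ∀ {P R Q : ℕ → Set} (P? : ∀ q → Dec (P q)) (R? : ∀ q → Dec (R q)) (Q? : ∀ q → Dec (Q q)) N
        → (∀ q → q < N → indicator (P? q) ≡ indicator (R? q) + indicator (Q? q))
        → count P? N ≡ count R? N + count Q? N
count-+ P? R? Q? zero _ = refl
count-+ P? R? Q? (suc N) split = begin
  count P? (suc N)
    ≡⟨ count-suc P? N ⟩
  count P? N + indicator (P? N)
    ≡⟨ cong₂ _+_ (count-+ P? R? Q? N (λ q q<N → split q (ℕP.m≤n⇒m≤1+n q<N))) (split N ℕP.≤-refl) ⟩
  (count R? N + count Q? N) + (indicator (R? N) + indicator (Q? N))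
    ≡⟨ +-interchange (count R? N) _ _ _ ⟩
  (count R? N + indicator (R? N)) + (count Q? N + indicator (Q? N))
    ≡⟨ sym (cong₂ _+_ (count-suc R? N) (count-suc Q? N)) ⟩
  count R? (suc N) + count Q? (suc N) ∎
  where open ≡-Reasoning

count-single : ∀ p N → p < N → count (_≟ p) N ≡ 1
count-single p (suc N) p<1+N with ℕP.m≤n⇒m<n∨m≡n p<1+N
... | inj₁ (s≤s p<N) = begin
  count (_≟ p) (suc N)                  ≡⟨ count-suc (_≟ p) N ⟩
  count (_≟ p) N + indicator (N ≟ p)    ≡⟨ cong₂ _+_ (count-single p N p<N) (indicator-no (N ≟ p) (ℕP.<⇒≢ p<N ∘′ sym)) ⟩
  1                                     ∎
  where open ≡-Reasoning
... | inj₂ refl = begin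
  count (_≟ N) (suc N)                  ≡⟨ count-suc (_≟ N) N ⟩
  count (_≟ N) N + indicator (N ≟ N)    ≡⟨ cong₂ _+_ (count-none (_≟ N) N (λ q q<N → ℕP.<⇒≢ q<N)) (indicator-yes (N ≟ N) refl) ⟩
  1                                     ∎
  where open ≡-Reasoning

-- The Möbius function at p·e.

Squarefree : ℕ → Set
Squarefree n = ∀ k → 2 ≤ k → k ≤ n → ¬ (k * k ∣ n)

T-¬? : ∀ {P : Set} (D : Dec P) → T (does (¬? D)) ⇔ (¬ P)
T-¬? (yes p) = mk⇔ (λ ()) (λ ¬p → ¬p p)
T-¬? (no ¬p) = mk⇔ (λ _ → ¬p) _

module _ (n : ℕ) where

  private
    noSquare : ℕ → Bool
    noSquare k = (k <ᵇ 2) ∨ does (¬? (k * k ∣? n))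

  squarefreeᵇ-sound : T (squarefreeᵇ n) → Squarefree n
  squarefreeᵇ-sound sf (suc zero) (s≤s ())
  squarefreeᵇ-sound sf k@(suc (suc _)) _ k≤n =
    to (T-¬? (k * k ∣? n)) (AllP.applyUpTo⁻ (λ i → i) (suc n) (AllP.all⁺ noSquare (upTo (suc n)) sf) (s≤s k≤n))

  squarefreeᵇ-complete : Squarefree n → T (squarefreeᵇ n)
  squarefreeᵇ-complete sf = AllP.all⁻ noSquare (AllP.applyUpTo⁺₁ (λ i → i) (suc n) noSquare<)
    where
    noSquare< : ∀ {k} → k < suc n → T (noSquare k)
    noSquare< {zero} _ = tt
    noSquare< {suc zero} _ = tt
    noSquare< {k@(suc (suc _))} (s≤s k≤n) = from (T-¬? (k * k ∣? n)) (sf k (s≤s (s≤s z≤n)) k≤n)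

T-injective : ∀ {a b : Bool} → (T a → T b) → (T b → T a) → a ≡ b
T-injective {false} {false} _ _ = refl
T-injective {false} {true} _ b⇒a = ⊥-elim (b⇒a tt)
T-injective {true} {false} a⇒b _ = ⊥-elim (a⇒b tt)
T-injective {true} {true} _ _ = refl

prime≥2 : ∀ {p} → Prime p → 2 ≤ p
prime≥2 {p} pp = nonTrivial⇒n>1 p ⦃ prime⇒nonTrivial pp ⦄

prime∤⇒coprime : ∀ {p d} → Prime p → ¬ p ∣ d → Coprime d p
prime∤⇒coprime pp p∤d (i∣d , i∣p) with prime⇒irreducible pp i∣p
... | inj₁ i≡1 = i≡1
... | inj₂ refl = ⊥-elim (p∤d i∣d)

module _ {p e : ℕ} (pp : Prime p) (0<e : 0 < e) where

  private instance
    p≢0 : NonZero p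
    p≢0 = prime⇒nonZero pp
    e≢0 : NonZero e
    e≢0 = >-nonZero 0<e

  -- μ(p·e) = 0 when p ∣ e, since then p² ∣ p·e.
  μ-p∣ : p ∣ e → μ (p * e) ≡ 0ℤ
  μ-p∣ p∣e with squarefreeᵇ (p * e) in sf
  ... | false = refl
  ... | true = ⊥-elim (squarefreeᵇ-sound (p * e) (from T-≡ sf) p (prime≥2 pp) (ℕP.m≤m*n p e) (*-monoʳ-∣ p p∣e))

  module _ (p∤e : ¬ p ∣ e) where

    squarefree-p* : Squarefree (p * e) ⇔ Squarefree e
    squarefree-p* = mk⇔ toE fromE
      where
      toE : Squarefree (p * e) → Squarefree e
      toE sf k 2≤k k≤e k²∣e = sf k 2≤k (ℕP.≤-trans k≤e (ℕP.m≤n*m e p)) (∣n⇒∣m*n p k²∣e)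
      fromE : Squarefree e → Squarefree (p * e)
      fromE sf k 2≤k _ k²∣pe with p ∣? k
      ... | yes p∣k = p∤e (*-cancelˡ-∣ p (∣-trans (*-pres-∣ p∣k p∣k) k²∣pe))
      ... | no p∤k = sf k 2≤k k≤e k²∣e
        where
        p∤k² : ¬ p ∣ k * k
        p∤k² p∣k² = [ p∤k , p∤k ]′ (euclidsLemma k k pp p∣k²)
        k²∣e : k * k ∣ e
        k²∣e = coprime-divisor (prime∤⇒coprime pp p∤k²) k²∣pe
        k≤e : k ≤ e
        k≤e = ℕP.≤-trans (ℕP.m≤m*n k k ⦃ >-nonZero (ℕP.≤-trans (s≤s z≤n) 2≤k) ⦄) (∣⇒≤ k²∣e)

    primeDivisors-p* : length (primeDivisors (p * e)) ≡ suc (length (primeDivisors e))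
    primeDivisors-p* = begin
      count PD[pe] (suc (p * e))
        ≡⟨ count-+ PD[pe] (_≟ p) PD[e] (suc (p * e)) (λ q _ → indicator-⊎ (PD[pe] q) (q ≟ p) (PD[e] q) (primeDivisor-p* q) isNew) ⟩
      count (_≟ p) (suc (p * e)) + count PD[e] (suc (p * e))
        ≡⟨ cong₂ _+_ (count-single p (suc (p * e)) (s≤s (ℕP.m≤m*n p e))) (count-truncate PD[e] (suc e) (suc (p * e)) beyond-e (s≤s (ℕP.m≤n*m e p))) ⟩
      suc (count PD[e] (suc e)) ∎
      where
      open ≡-Reasoning
      PD[pe] PD[e] : ∀ q → Dec (Prime q × q ∣ _)
      PD[pe] q = prime? q ×-dec q ∣? p * e
      PD[e] q = prime? q ×-dec q ∣? e
      primeDivisor-p* : ∀ q → (Prime q × q ∣ p * e) ⇔ (q ≡ p ⊎ (Prime q × q ∣ e))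
      primeDivisor-p* q = mk⇔ toPD fromPD
        where
        toPD : Prime q × q ∣ p * e → q ≡ p ⊎ (Prime q × q ∣ e)
        toPD (pq , q∣pe) with euclidsLemma p e pq q∣pe
        ... | inj₂ q∣e = inj₂ (pq , q∣e)
        ... | inj₁ q∣p with prime⇒irreducible pp q∣p
        ...   | inj₁ refl = ⊥-elim (¬prime[1] pq)
        ...   | inj₂ q≡p = inj₁ q≡p
        fromPD : q ≡ p ⊎ (Prime q × q ∣ e) → Prime q × q ∣ p * e
        fromPD (inj₁ refl) = pp , m∣m*n e
        fromPD (inj₂ (pq , q∣e)) = pq , ∣n⇒∣m*n p q∣e
      isNew : ∀ {q} → q ≡ p → ¬ (Prime q × q ∣ e)
      isNew refl (_ , p∣e) = p∤e p∣e
      beyond-e : ∀ q → suc e ≤ q → ¬ (Prime q × q ∣ e)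
      beyond-e q e<q (_ , q∣e) = ℕP.<-irrefl refl (ℕP.<-≤-trans e<q (∣⇒≤ q∣e))

    μ-p∤ : μ (p * e) ≡ - μ e
    μ-p∤ = begin
      μ (p * e)
        ≡⟨ cong₂ (λ sf k → if sf then signPow k else 0ℤ) sameTest primeDivisors-p* ⟩
      (if squarefreeᵇ e then signPow (suc (length (primeDivisors e))) else 0ℤ)
        ≡⟨ negate (squarefreeᵇ e) ⟩
      - μ e ∎
      where
      open ≡-Reasoning
      sameTest : squarefreeᵇ (p * e) ≡ squarefreeᵇ e
      sameTest = T-injective
        (squarefreeᵇ-complete e ∘′ to squarefree-p* ∘′ squarefreeᵇ-sound (p * e))
        (squarefreeᵇ-complete (p * e) ∘′ from squarefree-p* ∘′ squarefreeᵇ-sound e)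
      negate : ∀ b → (if b then signPow (suc (length (primeDivisors e))) else 0ℤ)
                     ≡ - (if b then signPow (length (primeDivisors e)) else 0ℤ)
      negate true = refl
      negate false = refl

-- The Möbius divisor sum and orthogonality.

μ∣ : ℕ → ℕ → ℤ
μ∣ M d = when (d ∣? M) (μ d)

μ∣-beyond : ∀ M → 0 < M → ∀ d → M < d → μ∣ M d ≡ 0ℤ
μ∣-beyond M 0<M d M<d = when-no (d ∣? M) λ d∣M → ℕP.<⇒≱ M<d (∣⇒≤ ⦃ >-nonZero 0<M ⦄ d∣M)

one-or-prime-multiple : ∀ M → 0 < M → M ≡ 1 ⊎ ∃[ p ] ∃[ m ] (Prime p × M ≡ p * m)
one-or-prime-multiple M 0<M with factorise M ⦃ >-nonZero 0<M ⦄
... | record { factors = [] ; isFactorisation = M≡1 } = inj₁ M≡1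
... | record { factors = p ∷ ps ; isFactorisation = M≡pm ; factorsPrime = pp ∷ _ } = inj₂ (p , product ps , pp , M≡pm)

-- Σ_{d ∣ p·m} μ(d) = 0: the divisors not divisible by p cancel against
-- their multiples by p, since μ(p·e) = −μ(e) for p ∤ e and 0 for p ∣ e.
μ-divisorSum-prime-multiple : ∀ p m → Prime p → 0 < m → sumTo (μ∣ (p * m)) (p * m) ≡ 0ℤ
μ-divisorSum-prime-multiple p m pp 0<m = begin
  sumTo (μ∣ N) N
    ≡⟨ sumTo-cong N (λ d _ _ → when-split (p ∣? d) (μ∣ N d)) ⟩
  sumTo (λ d → coprimePart d +ℤ pPart d) N
    ≡⟨ sumMap-+ coprimePart pPart (range1 N) ⟩
  sumTo coprimePart N +ℤ sumTo pPart N
    ≡⟨ cong₂ _+ℤ_ (sumTo-cong N (λ d _ _ → coprimePart-m d)) (sumTo-multiples pPart p m 0<p pPart-p∣) ⟩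
  sumTo coprimePart′ N +ℤ sumTo (λ e → pPart (p * e)) m
    ≡⟨ cong₂ _+ℤ_ (sumTo-truncate coprimePart′ m N coprimePart′-beyond (ℕP.m≤n*m m p)) (sumTo-cong m (λ e 0<e _ → pPart-p* e 0<e)) ⟩
  sumTo coprimePart′ m +ℤ sumTo (λ e → - coprimePart′ e) m
    ≡⟨ cong (sumTo coprimePart′ m +ℤ_) (sumMap-neg coprimePart′ (range1 m)) ⟩
  sumTo coprimePart′ m +ℤ - sumTo coprimePart′ m
    ≡⟨ ℤP.+-inverseʳ (sumTo coprimePart′ m) ⟩
  0ℤ ∎
  where
  open ≡-Reasoning
  instance
    p≢0 : NonZero p
    p≢0 = prime⇒nonZero pp
  N = p * m
  0<p : 0 < p
  0<p = ℕP.≤-trans (s≤s z≤n) (prime≥2 pp)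
  coprimePart pPart coprimePart′ : ℕ → ℤ
  coprimePart d = when (¬? (p ∣? d)) (μ∣ N d)
  pPart d = when (p ∣? d) (μ∣ N d)
  coprimePart′ d = when (¬? (p ∣? d)) (μ∣ m d)
  -- for p ∤ d, d ∣ p·m iff d ∣ m
  coprimePart-m : ∀ d → coprimePart d ≡ coprimePart′ d
  coprimePart-m d with p ∣? d
  ... | yes _ = refl
  ... | no p∤d = when-cong (d ∣? N) (d ∣? m) (mk⇔ (coprime-divisor (prime∤⇒coprime pp p∤d)) (∣n⇒∣m*n p))
  coprimePart′-beyond : ∀ d → m < d → coprimePart′ d ≡ 0ℤ
  coprimePart′-beyond d m<d = trans (cong (when (¬? (p ∣? d))) (μ∣-beyond m 0<m d m<d)) (when-0 (¬? (p ∣? d)))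
  pPart-p∣ : ∀ d → ¬ p ∣ d → pPart d ≡ 0ℤ
  pPart-p∣ d = when-no (p ∣? d)
  pPart-p* : ∀ e → 0 < e → pPart (p * e) ≡ - coprimePart′ e
  pPart-p* e 0<e with p ∣? e
  ... | yes p∣e = begin
    pPart (p * e)                 ≡⟨ when-yes (p ∣? p * e) (m∣m*n e) ⟩
    when (p * e ∣? N) (μ (p * e)) ≡⟨ cong (when (p * e ∣? N)) (μ-p∣ pp 0<e p∣e) ⟩
    when (p * e ∣? N) 0ℤ          ≡⟨ when-0 (p * e ∣? N) ⟩
    0ℤ                            ∎
  ... | no p∤e = begin
    pPart (p * e)                   ≡⟨ when-yes (p ∣? p * e) (m∣m*n e) ⟩
    when (p * e ∣? N) (μ (p * e))   ≡⟨ cong (when (p * e ∣? N)) (μ-p∤ pp 0<e p∤e) ⟩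
    when (p * e ∣? N) (- μ e)       ≡⟨ when-neg (p * e ∣? N) (μ e) ⟩
    - when (p * e ∣? N) (μ e)       ≡⟨ cong -_ (when-cong (p * e ∣? N) (e ∣? m) (mk⇔ (*-cancelˡ-∣ p) (*-monoʳ-∣ p))) ⟩
    - μ∣ m e                        ∎

μ-divisorSum : ∀ M B → 0 < M → M ≤ B → sumTo (μ∣ M) B ≡ 𝟙 (M ≟ 1)
μ-divisorSum M B 0<M M≤B = trans (sumTo-truncate (μ∣ M) M B (μ∣-beyond M 0<M) M≤B) (divisorSum M 0<M)
  where
  divisorSum : ∀ M → 0 < M → sumTo (μ∣ M) M ≡ 𝟙 (M ≟ 1)
  divisorSum M 0<M with one-or-prime-multiple M 0<M
  ... | inj₁ refl = refl
  ... | inj₂ (p , m , pp , refl) = begin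
    sumTo (μ∣ (p * m)) (p * m)   ≡⟨ μ-divisorSum-prime-multiple p m pp 0<m ⟩
    0ℤ                           ≡⟨ sym (when-no (p * m ≟ 1) (λ pm≡1 → ¬prime[1] (subst Prime (ℕP.m*n≡1⇒m≡1 p m pm≡1) pp))) ⟩
    𝟙 (p * m ≟ 1)                ∎
    where
    open ≡-Reasoning
    0<m : 0 < m
    0<m = >-nonZero⁻¹ m ⦃ ℕP.m*n≢0⇒n≢0 p ⦃ >-nonZero 0<M ⦄ ⦄

μ-orthogonality : ∀ a N B → 0 < a → 0 < N → N ≤ B → sumTo (λ d → μ d *ℤ 𝟙 (d * a ∣? N)) B ≡ 𝟙 (a ≟ N)
μ-orthogonality a N B 0<a 0<N N≤B with a ∣? N
... | no a∤N = begin
  sumTo (λ d → μ d *ℤ 𝟙 (d * a ∣? N)) B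
    ≡⟨ sumTo-zero B (λ d _ _ → trans (sym (when-scale (d * a ∣? N) (μ d))) (when-no (d * a ∣? N) (a∤N ∘′ m*n∣⇒n∣ d a))) ⟩
  0ℤ
    ≡⟨ sym (when-no (a ≟ N) λ { refl → a∤N ∣-refl }) ⟩
  𝟙 (a ≟ N) ∎
  where open ≡-Reasoning
... | yes (divides q N≡qa) = begin
  sumTo (λ d → μ d *ℤ 𝟙 (d * a ∣? N)) B
    ≡⟨ sumTo-cong B (λ d _ _ → trans (sym (when-scale (d * a ∣? N) (μ d))) (when-cong (d * a ∣? N) (d ∣? q) (da∣N⇔d∣q d))) ⟩
  sumTo (μ∣ q) B
    ≡⟨ μ-divisorSum q B 0<q q≤B ⟩
  𝟙 (q ≟ 1)
    ≡⟨ when-cong (q ≟ 1) (a ≟ N) (mk⇔ q≡1⇒a≡N a≡N⇒q≡1) ⟩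
  𝟙 (a ≟ N) ∎
  where
  open ≡-Reasoning
  instance
    a≢0 : NonZero a
    a≢0 = >-nonZero 0<a
  da∣N⇔d∣q : ∀ d → (d * a ∣ N) ⇔ (d ∣ q)
  da∣N⇔d∣q d = mk⇔ (λ da∣N → *-cancelʳ-∣ a (subst (d * a ∣_) N≡qa da∣N)) (λ d∣q → subst (d * a ∣_) (sym N≡qa) (*-monoˡ-∣ a d∣q))
  0<q : 0 < q
  0<q = ℕP.n≢0⇒n>0 λ { refl → ℕP.<⇒≢ 0<N (sym N≡qa) }
  q≤B : q ≤ B
  q≤B = ℕP.≤-trans (subst (q ≤_) (sym N≡qa) (ℕP.m≤m*n q a)) N≤B
  q≡1⇒a≡N : q ≡ 1 → a ≡ N
  q≡1⇒a≡N refl = sym (trans N≡qa (ℕP.+-identityʳ a))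
  a≡N⇒q≡1 : a ≡ N → q ≡ 1
  a≡N⇒q≡1 a≡N = ℕP.*-cancelʳ-≡ q 1 a (trans (sym N≡qa) (trans (sym a≡N) (sym (ℕP.+-identityʳ a))))

-- The sieve over a gcd-closed set x_0 < x_1 < … < x_{n-1}.

module GcdClosed (n : ℕ) (x : Fin n → ℕ)
    (pos : ∀ i → 0 < x i)
    (increasing : ∀ i j → i Fin.< j → x i < x j)
    (gcd-closed : ∀ i j → ∃[ k ] gcd (x i) (x j) ≡ x k)
    where

  x-injective : ∀ {i k} → x i ≡ x k → i ≡ k
  x-injective {i} {k} xi≡xk with FinP.<-cmp i k
  ... | tri< i<k _ _ = ⊥-elim (ℕP.<⇒≢ (increasing i k i<k) xi≡xk)
  ... | tri≈ _ i≡k _ = i≡k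
  ... | tri> _ _ k<i = ⊥-elim (ℕP.<⇒≢ (increasing k i k<i) (sym xi≡xk))

  _⊓_ : Fin n → Fin n → Fin n
  t ⊓ s = proj₁ (gcd-closed t s)

  x-⊓ : ∀ t s → x (t ⊓ s) ≡ gcd (x t) (x s)
  x-⊓ t s = sym (proj₂ (gcd-closed t s))

  ⊓-≤ : ∀ t s → x (t ⊓ s) ≤ x t
  ⊓-≤ t s = subst (_≤ x t) (sym (x-⊓ t s)) (∣⇒≤ ⦃ >-nonZero (pos t) ⦄ (gcd[m,n]∣m (x t) (x s)))

  ∣-⊓ : ∀ m t s → m ∣ x (t ⊓ s) ⇔ (m ∣ x t × m ∣ x s)
  ∣-⊓ m t s = mk⇔
    (λ m∣x⊓ → let m∣gcd = subst (m ∣_) (x-⊓ t s) m∣x⊓ in ∣-trans m∣gcd (gcd[m,n]∣m (x t) (x s)) , ∣-trans m∣gcd (gcd[m,n]∣n (x t) (x s)))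
    (λ (m∣xt , m∣xs) → subst (m ∣_) (sym (x-⊓ t s)) (gcd-greatest m∣xt m∣xs))

  DividesSome : List (Fin n) → ℕ → Set
  DividesSome L m = Any (λ u → m ∣ x u) L

  dividesSome? : ∀ L m → Dec (DividesSome L m)
  dividesSome? L m = any? (λ u → m ∣? x u) L

  U : List (Fin n) → ℕ → ℤ
  U L m = 𝟙 (dividesSome? L m)

  divisorsOf : ℕ → ℕ → ℤ
  divisorsOf y m = 𝟙 (m ∣? y)

  dividesSome-⊓ : ∀ m t L → DividesSome (map (t ⊓_) L) m ⇔ (m ∣ x t × DividesSome L m)
  dividesSome-⊓ m t L = mk⇔ toPair fromPair
    where
    toPair : DividesSome (map (t ⊓_) L) m → m ∣ x t × DividesSome L m
    toPair some = let some′ = AnyP.map⁻ some in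
      proj₁ (to (∣-⊓ m t _) (proj₂ (Any.satisfied some′))) , Any.map (λ {s} → proj₂ ∘′ to (∣-⊓ m t s)) some′
    fromPair : m ∣ x t × DividesSome L m → DividesSome (map (t ⊓_) L) m
    fromPair (m∣xt , some) = AnyP.map⁺ (Any.map (λ {s} m∣xs → from (∣-⊓ m t s) (m∣xt , m∣xs)) some)

  U-∷ : ∀ t L m → U (t ∷ L) m ≡ (divisorsOf (x t) m +ℤ U L m) -ℤ U (map (t ⊓_) L) m
  U-∷ t L m = 𝟙-∨ (m ∣? x t) (dividesSome? L m) (dividesSome? (t ∷ L) m) (dividesSome? (map (t ⊓_) L) m)
    (mk⇔ (λ { (here m∣xt) → inj₁ m∣xt ; (there some) → inj₂ some }) [ here , there ]′)
    (dividesSome-⊓ m t L)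

  module Sieve (X : ℕ) where

    Φ : (ℕ → ℤ) → ℤ
    Φ h = sumMap (λ i → sumTo (λ d → μ d *ℤ h (d * x i)) X) (allFin n)

    Φ-cong : ∀ {h h′} → (∀ m → h m ≡ h′ m) → Φ h ≡ Φ h′
    Φ-cong h≗h′ = sumMap-cong (allFin n) (λ i → sumMap-cong (range1 X) (λ d → cong (μ d *ℤ_) (h≗h′ (d * x i))))

    Φ-+ : ∀ h h′ → Φ (λ m → h m +ℤ h′ m) ≡ Φ h +ℤ Φ h′
    Φ-+ h h′ = trans
      (sumMap-cong (allFin n) λ i → trans
        (sumMap-cong (range1 X) (λ d → ℤP.*-distribˡ-+ (μ d) (h (d * x i)) (h′ (d * x i))))
        (sumMap-+ _ _ (range1 X)))
      (sumMap-+ _ _ (allFin n))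

    Φ-neg : ∀ h → Φ (λ m → - h m) ≡ - Φ h
    Φ-neg h = trans
      (sumMap-cong (allFin n) λ i → trans
        (sumMap-cong (range1 X) (λ d → sym (ℤP.neg-distribʳ-* (μ d) (h (d * x i)))))
        (sumMap-neg _ (range1 X)))
      (sumMap-neg _ (allFin n))

    Φ-- : ∀ h h′ → Φ (λ m → h m -ℤ h′ m) ≡ Φ h -ℤ Φ h′
    Φ-- h h′ = trans (Φ-+ h (λ m → - h′ m)) (cong (Φ h +ℤ_) (Φ-neg h′))

    Bounded : Fin n → Set
    Bounded t = x t ≤ X

    -- Φ [· ∣ x_k] = 1 for x_k ≤ X: by orthogonality only i = k contributes.
    Φ-divisors : ∀ k → Bounded k → Φ (divisorsOf (x k)) ≡ 1ℤ
    Φ-divisors k bk = begin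
      Φ (divisorsOf (x k))                       ≡⟨ sumMap-cong (allFin n) (λ i → μ-orthogonality (x i) (x k) X (pos i) (pos k) bk) ⟩
      sumMap (λ i → 𝟙 (x i ≟ x k)) (allFin n)    ≡⟨ sumMap-allFin-point n _ k (λ i i≢k → when-no (x i ≟ x k) (i≢k ∘′ x-injective)) ⟩
      𝟙 (x k ≟ x k)                              ≡⟨ when-yes (x k ≟ x k) refl ⟩
      1ℤ                                         ∎
      where open ≡-Reasoning

    Φ-union : ∀ {u} L → u ∈ L → All Bounded L → Φ (U L) ≡ 1ℤ
    Φ-union (t ∷ L) _ (bt ∷ bL) = go (length L) t L ℕP.≤-refl bt bL
      where
      go : ∀ k t L → length L ≤ k → Bounded t → All Bounded L → Φ (U (t ∷ L)) ≡ 1ℤ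
      go k t [] _ bt _ = trans (Φ-cong single) (Φ-divisors t bt)
        where
        single : ∀ m → U [ t ] m ≡ divisorsOf (x t) m
        single m = when-cong (dividesSome? [ t ] m) (m ∣? x t) (mk⇔ (λ { (here m∣xt) → m∣xt ; (there ()) }) here)
      go (suc k) t (s ∷ L) (s≤s |L|≤k) bt (bs ∷ bL) = begin
        Φ (U (t ∷ s ∷ L))
          ≡⟨ Φ-cong (U-∷ t (s ∷ L)) ⟩
        Φ (λ m → (divisorsOf (x t) m +ℤ U (s ∷ L) m) -ℤ U (t⊓L) m)
          ≡⟨ Φ-- (λ m → divisorsOf (x t) m +ℤ U (s ∷ L) m) (U t⊓L) ⟩
        Φ (λ m → divisorsOf (x t) m +ℤ U (s ∷ L) m) -ℤ Φ (U t⊓L)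
          ≡⟨ cong (_-ℤ Φ (U t⊓L)) (Φ-+ (divisorsOf (x t)) (U (s ∷ L))) ⟩
        (Φ (divisorsOf (x t)) +ℤ Φ (U (s ∷ L))) -ℤ Φ (U t⊓L)
          ≡⟨ cong₂ _-ℤ_ (cong₂ _+ℤ_ (Φ-divisors t bt) (go k s L |L|≤k bs bL)) (go k (t ⊓ s) (map (t ⊓_) L) |t⊓L|≤k (bounded-⊓ s) (AllP.map⁺ (universal bounded-⊓ L))) ⟩
        (1ℤ +ℤ 1ℤ) -ℤ 1ℤ
          ≡⟨⟩
        1ℤ ∎
        where
        open ≡-Reasoning
        t⊓L : List (Fin n)
        t⊓L = map (t ⊓_) (s ∷ L)
        bounded-⊓ : ∀ s → Bounded (t ⊓ s)
        bounded-⊓ s = ℕP.≤-trans (⊓-≤ t s) bt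
        |t⊓L|≤k : length (map (t ⊓_) L) ≤ k
        |t⊓L|≤k = subst (_≤ k) (sym (ListP.length-map (t ⊓_) L)) |L|≤k

  module Column (j : Fin n) where

    X : ℕ
    X = x j

    open Sieve X

    Fresh : ℕ → Set
    Fresh m = m ∣ X × (∀ t → x t < X → ¬ m ∣ x t)

    fresh? : ∀ m → Dec (Fresh m)
    fresh? m = (m ∣? X) ×-dec FinP.all? (λ t → (x t <? X) →-dec ¬? (m ∣? x t))

    c-as-sieve : ∀ i → c x i j ≡ sumTo (λ d → μ d *ℤ 𝟙 (fresh? (d * x i))) X
    c-as-sieve i = sumMap-cong (range1 X) (λ d → when-scale (fresh? (d * x i)) (μ d))

    c-non-divisor : ∀ i → ¬ x i ∣ X → c x i j ≡ 0ℤ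
    c-non-divisor i xi∤X = sumTo-zero X (λ d _ _ → when-no (fresh? (d * x i)) (xi∤X ∘′ m*n∣⇒n∣ d (x i) ∘′ proj₁))

    below : List (Fin n)
    below = filter (λ t → x t <? X) (allFin n)

    fresh-as-difference : ∀ m → 𝟙 (fresh? m) ≡ divisorsOf X m -ℤ U (map (j ⊓_) below) m
    fresh-as-difference m = 𝟙-∖ (m ∣? X) (dividesSome? below m) (fresh? m) (dividesSome? (map (j ⊓_) below) m)
      (mk⇔ toPair fromPair) (dividesSome-⊓ m j below)
      where
      toPair : Fresh m → m ∣ X × ¬ DividesSome below m
      toPair (m∣X , fresh) = m∣X , λ some →
        let (t , t∈below , m∣xt) = find some in fresh t (proj₂ (∈P.∈-filter⁻ (λ t → x t <? X) {xs = allFin n} t∈below)) m∣xt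
      fromPair : m ∣ X × ¬ DividesSome below m → Fresh m
      fromPair (m∣X , none) = m∣X , λ t xt<X m∣xt → none (lose (∈P.∈-filter⁺ (λ t → x t <? X) (∈P.∈-allFin t) xt<X) m∣xt)

    -- For j ≥ 1 the element x_0 lies below x_j, so j⊓below is non-empty
    -- and Σ_i c_{ij} = Φ [· ∣ x_j] − Φ U_{j⊓below} = 1 − 1.
    column-sum : 1 ≤ toℕ j → sumAllC x j ≡ 0ℤ
    column-sum 1≤j = begin
      sumAllC x j
        ≡⟨ sumMap-cong (allFin n) c-as-sieve ⟩
      Φ (λ m → 𝟙 (fresh? m))
        ≡⟨ Φ-cong fresh-as-difference ⟩
      Φ (λ m → divisorsOf X m -ℤ U j⊓below m)
        ≡⟨ Φ-- (divisorsOf X) (U j⊓below) ⟩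
      Φ (divisorsOf X) -ℤ Φ (U j⊓below)
        ≡⟨ cong₂ _-ℤ_ (Φ-divisors j ℕP.≤-refl) (Φ-union j⊓below j⊓first∈ (AllP.map⁺ (universal (⊓-≤ j) below))) ⟩
      1ℤ -ℤ 1ℤ
        ≡⟨⟩
      0ℤ ∎
      where
      open ≡-Reasoning
      j⊓below : List (Fin n)
      j⊓below = map (j ⊓_) below
      0<n : 0 < n
      0<n = ℕP.<-trans 1≤j (FinP.toℕ<n j)
      first : Fin n
      first = Fin.fromℕ< 0<n
      first<j : x first < X
      first<j = increasing first j (subst (_< toℕ j) (sym (FinP.toℕ-fromℕ< 0<n)) 1≤j)
      j⊓first∈ : j ⊓ first ∈ j⊓below
      j⊓first∈ = ∈P.∈-map⁺ (j ⊓_) (∈P.∈-filter⁺ (λ t → x t <? X) (∈P.∈-allFin first) first<j)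

    divisor-column-sum : 1 ≤ toℕ j → sumDivC x j ≡ 0ℤ
    divisor-column-sum 1≤j = trans (sumMap-filter (λ i → x i ∣? X) (λ i → c x i j) (allFin n) c-non-divisor) (column-sum 1≤j)

lemma2p8 : (n : ℕ) (x : Fin n → ℕ)
    → (∀ i → 0 < x i)
    → (∀ i j → i Fin.< j → x i < x j)
    → (∀ i j → ∃[ k ] gcd (x i) (x j) ≡ x k)
    → (j : Fin n) → 1 ≤ toℕ j
    → (sumAllC x j ≡ 0ℤ) × (sumDivC x j ≡ 0ℤ)
lemma2p8 n x pos increasing gcd-closed j 1≤j = column-sum 1≤j , divisor-column-sum 1≤j
  where open GcdClosed.Column n x pos increasing gcd-closed j
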